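{- Let $$K_0=\begin{pmatrix}1&0\\1&1\end{pmatrix},\qquad K_1=\begin{pmatrix}0&1\\1&1\end{pmatrix}.$$ The monoid of $2\times 2$ integer matrices generated by $K_0$ and $K_1$ (under matrix multiplication) is free on $\{K_0,K_1\}$: if $i_1\dots i_n$ and $j_1\dots j_m$ ($n,m\ge 0$) are two distinct finite strings over $\{0,1\}$, then $K_{i_n}\cdots K_{i_1}\neq K_{j_m}\cdots K_{j_1}$ (the empty product being the identity matrix). -}

module Defs where

open import Data.Integer using (ℤ; _+_; _*_; 0ℤ; 1ℤ)
open import Data.Fin using (Fin; zero; suc)
open import Data.List using (List; []; _∷_)

-- 2×2 integer matrices, entries indexed by Fin 2 × Fin 2 (row, column)
Mat₂ : Set
Mat₂ = Fin 2 → Fin 2 → ℤ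

_·_ : Mat₂ → Mat₂ → Mat₂
(A · B) i j = A i zero * B zero j + A i (suc zero) * B (suc zero) j

I₂ : Mat₂
I₂ zero          zero          = 1ℤ
I₂ zero          (suc zero)    = 0ℤ
I₂ (suc zero)    zero          = 0ℤ
I₂ (suc zero)    (suc zero)    = 1ℤ

K : Fin 2 → Mat₂
K zero zero          zero          = 1ℤ
K zero zero          (suc zero)    = 0ℤ
K zero (suc zero)    zero          = 1ℤ
K zero (suc zero)    (suc zero)    = 1ℤ
K (suc zero) zero          zero          = 0ℤ
K (suc zero) zero          (suc zero)    = 1ℤ
K (suc zero) (suc zero)    zero          = 1ℤ
K (suc zero) (suc zero)    (suc zero)    = 1ℤ

-- For the string i₁ i₂ … iₙ (as the list i₁ ∷ i₂ ∷ … ∷ iₙ ∷ []),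
-- prod gives K_{iₙ} ⋯ K_{i₂} K_{i₁}; the empty product is I₂.
prod : List (Fin 2) → Mat₂
prod []       = I₂
prod (i ∷ is) = prod is · K i

module Submission where

-- Idea: multiply a product of generators on the left by the row vector (1,1),
-- i.e. take its pair of column sums.  Right multiplication by K₀ sends the
-- column sums (x , y) to (x + y , y), and by K₁ to (y , x + y).  Starting from
-- (1 , 1) for the empty product, every pair reached has positive entries, so
-- the last letter applied can be read off the pair: K₀ makes the first entry
-- the larger one, K₁ the second one, and the empty word leaves them equal.
-- Since each of the two steps is also injective, the column sums — and hence
-- the matrix — determine the word (this is the Calkin–Wilf encoding).

open import Defs
open import Data.Fin using (Fin; zero; suc)
open import Data.List using (List; []; _∷_)
open import Data.Nat as ℕ using (ℕ; _<_)
open import Data.Nat.Properties using (m<n+m; m≤m+n; ≤-trans; <-irrefl; <-asym; +-cancelʳ-≡)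
open import Data.Integer as ℤ using (ℤ; +_; 0ℤ; 1ℤ)
open import Data.Integer.Properties using (pos-+; +-injective)
open import Data.Integer.Tactic.RingSolver using (solve-∀)
open import Data.Product using (_×_; _,_; proj₁; proj₂)
open import Data.Product.Properties using (,-injective)
open import Data.Empty using (⊥-elim)
open import Relation.Binary.PropositionalEquality
  using (_≡_; _≢_; refl; sym; trans; cong; cong₂; subst; module ≡-Reasoning)
open import Relation.Nullary using (¬_)

-- The effect of right multiplication by K i on the column sums (x , y).
act : Fin 2 → ℕ × ℕ → ℕ × ℕ
act zero       (x , y) = x ℕ.+ y , y
act (suc zero) (x , y) = y , x ℕ.+ y

sums : List (Fin 2) → ℕ × ℕ
sums []       = 1 , 1
sums (i ∷ is) = act i (sums is)

act-injective : ∀ i {p q : ℕ × ℕ} → act i p ≡ act i q → p ≡ q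
act-injective zero       {x , y} {x′ , y′} e with ,-injective e
... | e₁ , refl = cong (_, y) (+-cancelʳ-≡ y x x′ e₁)
act-injective (suc zero) {x , y} {x′ , y′} e with ,-injective e
... | refl , e₂ = cong (_, y) (+-cancelʳ-≡ y x x′ e₂)

Positive : ℕ × ℕ → Set
Positive (x , y) = 0 < x × 0 < y

act-positive : ∀ i {p} → Positive p → Positive (act i p)
act-positive zero       {x , y} (x>0 , y>0) = ≤-trans x>0 (m≤m+n x y) , y>0
act-positive (suc zero) {x , y} (x>0 , y>0) = y>0 , ≤-trans x>0 (m≤m+n x y)

sums-positive : ∀ u → Positive (sums u)
sums-positive []       = ℕ.s≤s ℕ.z≤n , ℕ.s≤s ℕ.z≤n
sums-positive (i ∷ is) = act-positive i (sums-positive is)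

Leans : Fin 2 → ℕ × ℕ → Set
Leans zero       (x , y) = y < x
Leans (suc zero) (x , y) = x < y

act-leans : ∀ i {p} → Positive p → Leans i (act i p)
act-leans zero       {x , y} (x>0 , _) = m<n+m y x>0
act-leans (suc zero) {x , y} (x>0 , _) = m<n+m y x>0

sums-leans : ∀ i is → Leans i (sums (i ∷ is))
sums-leans i is = act-leans i (sums-positive is)

leans-unique : ∀ i j {p} → Leans i p → Leans j p → i ≡ j
leans-unique zero       zero       _   _   = refl
leans-unique zero       (suc zero) y<x x<y = ⊥-elim (<-asym y<x x<y)
leans-unique (suc zero) zero       x<y y<x = ⊥-elim (<-asym y<x x<y)
leans-unique (suc zero) (suc zero) _   _   = refl

diagonal-not-leans : ∀ i n → ¬ Leans i (n , n)
diagonal-not-leans zero       n = <-irrefl refl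
diagonal-not-leans (suc zero) n = <-irrefl refl

sums-injective : ∀ u v → sums u ≡ sums v → u ≡ v
sums-injective []       []       _ = refl
sums-injective []       (j ∷ js) e =
  ⊥-elim (diagonal-not-leans j 1 (subst (Leans j) (sym e) (sums-leans j js)))
sums-injective (i ∷ is) []       e =
  ⊥-elim (diagonal-not-leans i 1 (subst (Leans i) e (sums-leans i is)))
sums-injective (i ∷ is) (j ∷ js) e
  with leans-unique i j (sums-leans i is) (subst (Leans j) (sym e) (sums-leans j js))
... | refl = cong (i ∷_) (sums-injective is js (act-injective i e))

colSums : Mat₂ → ℤ × ℤ
colSums A = A zero zero ℤ.+ A (suc zero) zero , A zero (suc zero) ℤ.+ A (suc zero) (suc zero)

embed : ℕ × ℕ → ℤ × ℤ
embed (x , y) = + x , + y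

embed-injective : ∀ {p q : ℕ × ℕ} → embed p ≡ embed q → p ≡ q
embed-injective {x , y} {x′ , y′} e with ,-injective e
... | e₁ , e₂ = cong₂ _,_ (+-injective e₁) (+-injective e₂)

colSums-cong : ∀ {A B : Mat₂} → (∀ i j → A i j ≡ B i j) → colSums A ≡ colSums B
colSums-cong h = cong₂ _,_ (cong₂ ℤ._+_ (h zero zero) (h (suc zero) zero))
                           (cong₂ ℤ._+_ (h zero (suc zero)) (h (suc zero) (suc zero)))

-- The two ring identities behind `colSums-·K`: a column of A · K i is either
-- the sum of both columns of A (coefficients 1, 1) or its second column
-- (coefficients 0, 1).
both-columns : ∀ a b c d → (a ℤ.* 1ℤ ℤ.+ b ℤ.* 1ℤ) ℤ.+ (c ℤ.* 1ℤ ℤ.+ d ℤ.* 1ℤ) ≡ (a ℤ.+ c) ℤ.+ (b ℤ.+ d)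
both-columns = solve-∀

second-column : ∀ a b c d → (a ℤ.* 0ℤ ℤ.+ b ℤ.* 1ℤ) ℤ.+ (c ℤ.* 0ℤ ℤ.+ d ℤ.* 1ℤ) ≡ b ℤ.+ d
second-column = solve-∀

colSums-·K : ∀ (A : Mat₂) i p → colSums A ≡ embed p → colSums (A · K i) ≡ embed (act i p)
colSums-·K A i (x , y) e = step i
  where
  open ≡-Reasoning
  a b c d : ℤ
  a = A zero zero
  b = A zero (suc zero)
  c = A (suc zero) zero
  d = A (suc zero) (suc zero)

  second : b ℤ.+ d ≡ + y
  second = proj₂ (,-injective e)

  total : (a ℤ.+ c) ℤ.+ (b ℤ.+ d) ≡ + (x ℕ.+ y)
  total = begin
    (a ℤ.+ c) ℤ.+ (b ℤ.+ d) ≡⟨ cong₂ ℤ._+_ (proj₁ (,-injective e)) second ⟩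
    + x ℤ.+ + y             ≡⟨ pos-+ x y ⟨
    + (x ℕ.+ y)             ∎

  step : ∀ i → colSums (A · K i) ≡ embed (act i (x , y))
  step zero       = cong₂ _,_ (trans (both-columns a b c d) total) (trans (second-column a b c d) second)
  step (suc zero) = cong₂ _,_ (trans (second-column a b c d) second) (trans (both-columns a b c d) total)

colSums-prod : ∀ u → colSums (prod u) ≡ embed (sums u)
colSums-prod []       = refl
colSums-prod (i ∷ is) = colSums-·K (prod is) i (sums is) (colSums-prod is)

lemma1 : (u v : List (Fin 2)) → u ≢ v → ¬ (∀ (i j : Fin 2) → prod u i j ≡ prod v i j)
lemma1 u v u≢v same-matrix = u≢v (sums-injective u v (embed-injective equal-sums))
  where
  equal-sums : embed (sums u) ≡ embed (sums v)
  equal-sums = begin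
    embed (sums u)   ≡⟨ colSums-prod u ⟨
    colSums (prod u) ≡⟨ colSums-cong same-matrix ⟩
    colSums (prod v) ≡⟨ colSums-prod v ⟩
    embed (sums v)   ∎
    where open ≡-Reasoning
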